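{- The free group of rank $2$ is not weakly homogeneous.
   Context: A group $H$ is weakly homogeneous if for every isomorphism $\varphi:A\to B$ between two finitely generated subgroups $A,B$ of $H$ such that $\varphi$ extends to an endomorphism of $H$ and $\varphi^{ -1}:B\to A$ also extends to an endomorphism of $H$, the map $\varphi$ extends to an automorphism of $H$. -}

module Defs where

open import Level using (Level; _⊔_; suc)
open import Data.List using (List; []; _∷_; _++_; reverse; map; [_])
open import Data.List.Properties using (++-assoc; ++-identityʳ; reverse-++; map-++)
open import Data.List.Membership.Propositional using (_∈_)
open import Data.Product using (Σ; _×_; _,_; proj₁; proj₂; ∃)
open import Relation.Binary.PropositionalEquality as P using (_≡_)
open import Algebra.Bundles using (Group)
open import Algebra.Structures using (IsGroup; IsMonoid; IsSemigroup; IsMagma)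
open import Relation.Binary.Structures using (IsEquivalence)
import Algebra.Morphism.Structures as MS

module _ {c ℓ : Level} (G : Group c ℓ) where
  open Group G
  open MS.GroupMorphisms (Group.rawGroup G) (Group.rawGroup G)

  data ⟨_⟩ (gs : List Carrier) : Carrier → Set (c ⊔ ℓ) where
    gen : ∀ {g} → g ∈ gs → ⟨ gs ⟩ g
    one : ⟨ gs ⟩ ε
    inv : ∀ {x} → ⟨ gs ⟩ x → ⟨ gs ⟩ (x ⁻¹)
    mul : ∀ {x y} → ⟨ gs ⟩ x → ⟨ gs ⟩ y → ⟨ gs ⟩ (x ∙ y)
    resp : ∀ {x y} → x ≈ y → ⟨ gs ⟩ x → ⟨ gs ⟩ y

  Sub : List Carrier → Set (c ⊔ ℓ)
  Sub gs = Σ Carrier ⟨ gs ⟩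

  _·ₛ_ : ∀ {gs} → Sub gs → Sub gs → Sub gs
  (x , p) ·ₛ (y , q) = (x ∙ y , mul p q)

  record SubIso (gsA gsB : List Carrier) : Set (c ⊔ ℓ) where
    field
      to        : Sub gsA → Sub gsB
      from      : Sub gsB → Sub gsA
      to-cong   : ∀ x y → proj₁ x ≈ proj₁ y → proj₁ (to x) ≈ proj₁ (to y)
      from-cong : ∀ x y → proj₁ x ≈ proj₁ y → proj₁ (from x) ≈ proj₁ (from y)
      to-hom    : ∀ x y → proj₁ (to (x ·ₛ y)) ≈ proj₁ (to x) ∙ proj₁ (to y)
      from-to   : ∀ x → proj₁ (from (to x)) ≈ proj₁ x
      to-from   : ∀ y → proj₁ (to (from y)) ≈ proj₁ y

  Extends : ∀ {gs gs'} → (Sub gs → Sub gs') → (Carrier → Carrier) → Set (c ⊔ ℓ)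
  Extends ψ f = ∀ x → f (proj₁ x) ≈ proj₁ (ψ x)

  ExtendsToEndo : ∀ {gs gs'} → (Sub gs → Sub gs') → Set (c ⊔ ℓ)
  ExtendsToEndo ψ = Σ (Carrier → Carrier) λ f → IsGroupHomomorphism f × Extends ψ f

  ExtendsToAuto : ∀ {gs gs'} → (Sub gs → Sub gs') → Set (c ⊔ ℓ)
  ExtendsToAuto ψ = Σ (Carrier → Carrier) λ f → IsGroupIsomorphism f × Extends ψ f

  WeaklyHomogeneous : Set (c ⊔ ℓ)
  WeaklyHomogeneous =
    ∀ (gsA gsB : List Carrier) (φ : SubIso gsA gsB) →
    ExtendsToEndo (SubIso.to φ) → ExtendsToEndo (SubIso.from φ) →
    ExtendsToAuto (SubIso.to φ)

data Letter : Set where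
  a a⁻ b b⁻ : Letter

invL : Letter → Letter
invL a = a⁻
invL a⁻ = a
invL b = b⁻
invL b⁻ = b

invL-invol : ∀ x → invL (invL x) ≡ x
invL-invol a = P.refl
invL-invol a⁻ = P.refl
invL-invol b = P.refl
invL-invol b⁻ = P.refl

Word : Set
Word = List Letter

invW : Word → Word
invW w = reverse (map invL w)

infix 4 _~_
data _~_ : Word → Word → Set where
  ~refl   : ∀ {u} → u ~ u
  ~sym    : ∀ {u v} → u ~ v → v ~ u
  ~trans  : ∀ {u v w} → u ~ v → v ~ w → u ~ w
  cancel  : ∀ x → (x ∷ invL x ∷ []) ~ []
  ~cong   : ∀ {u u' v v'} → u ~ u' → v ~ v' → (u ++ v) ~ (u' ++ v')

private
  ≡⇒~ : ∀ {u v} → u ≡ v → u ~ v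
  ≡⇒~ P.refl = ~refl

  invW-++ : ∀ u v → invW (u ++ v) ≡ invW v ++ invW u
  invW-++ u v = P.trans (P.cong reverse (map-++ invL u v)) (reverse-++ (map invL u) (map invL v))

  invW-invol : ∀ u → invW (invW u) ≡ u
  invW-invol [] = P.refl
  invW-invol (x ∷ u) =
    P.trans (P.cong invW (invW-++ [ x ] u))
    (P.trans (invW-++ (invW u) [ invL x ])
      (P.cong₂ _∷_ (invL-invol x) (invW-invol u)))

  cancel' : ∀ x → (invL x ∷ x ∷ []) ~ []
  cancel' x = ~trans (≡⇒~ (P.cong (λ y → invL x ∷ y ∷ []) (P.sym (invL-invol x)))) (cancel (invL x))

  invW-cong : ∀ {u v} → u ~ v → invW u ~ invW v
  invW-cong ~refl = ~refl
  invW-cong (~sym p) = ~sym (invW-cong p)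
  invW-cong (~trans p q) = ~trans (invW-cong p) (invW-cong q)
  invW-cong (cancel x) = ~trans (≡⇒~ (P.cong (λ y → y ∷ invL x ∷ []) (invL-invol x))) (cancel x)
  invW-cong (~cong {u} {u'} {v} {v'} p q) =
    ~trans (≡⇒~ (invW-++ u v))
      (~trans (~cong (invW-cong q) (invW-cong p)) (≡⇒~ (P.sym (invW-++ u' v'))))

  invˡ : ∀ u → (invW u ++ u) ~ []
  invˡ [] = ~refl
  invˡ (x ∷ u) =
    ~trans (≡⇒~ (P.cong (_++ (x ∷ u)) (invW-++ [ x ] u)))
    (~trans (≡⇒~ (++-assoc (invW u) [ invL x ] (x ∷ u)))
    (~trans (~cong {invW u} {invW u} ~refl (~cong {invL x ∷ x ∷ []} {[]} {u} {u} (cancel' x) ~refl))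
    (invˡ u)))

  invʳ : ∀ u → (u ++ invW u) ~ []
  invʳ u = ~trans (≡⇒~ (P.cong (_++ invW u) (P.sym (invW-invol u)))) (invˡ (invW u))

F₂ : Group Level.zero Level.zero
F₂ = record
  { Carrier = Word
  ; _≈_ = _~_
  ; _∙_ = _++_
  ; ε = []
  ; _⁻¹ = invW
  ; isGroup = record
    { isMonoid = record
      { isSemigroup = record
        { isMagma = record
          { isEquivalence = record { refl = ~refl ; sym = ~sym ; trans = ~trans }
          ; ∙-cong = ~cong
          }
        ; assoc = λ x y z → ≡⇒~ (++-assoc x y z)
        }
      ; identity = (λ x → ~refl) , (λ x → ≡⇒~ (++-identityʳ x))
      }
    ; inverse = invˡ , invʳ
    ; ⁻¹-cong = invW-cong
    }
  }

module Submission where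

-- Let v = a a b a⁻¹ b and let φ : ⟨a⟩ → ⟨v⟩ send a to v.
-- φ extends to the endomorphism f = (a ↦ v, b ↦ b) and φ⁻¹ extends to
-- g = (a ↦ a, b ↦ 1), since g v = a a a⁻¹ = a.  An automorphism h
-- extending φ would make v primitive.  But a primitive element can only be
-- killed by homomorphisms with abelian image: if ρ v = 1 then ρ ∘ h kills a,
-- so the image of ρ ∘ h (which is the image of ρ) is generated by the single
-- element ρ (h b).  In the symmetric group S₃ a 3-cycle s and a
-- transposition t satisfy s² t s⁻¹ t = (s⁻¹ t)² = 1 without commuting, so
-- the homomorphism a ↦ s, b ↦ t kills v: contradiction.

open import Defs
open import Relation.Nullary using (¬_)

open import Level using (Level)
open import Data.List using ([]; _∷_; _++_; [_])
open import Data.List.Membership.Propositional using (_∈_)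
open import Data.List.Relation.Unary.Any using (here)
open import Data.Product using (_,_; proj₁; proj₂)
open import Data.Nat using (ℕ)
open import Data.Fin.Patterns using (0F; 1F; 2F)
open import Data.Fin.Permutation as Perm
  using (Permutation′; _⟨$⟩ʳ_; _⟨$⟩ˡ_; _∘ₚ_; transpose)
open import Relation.Binary.PropositionalEquality as ≡ using (_≡_)
open import Algebra.Bundles using (Group)
import Algebra.Properties.Group as GroupProperties
open import Algebra.Morphism.Structures using (module GroupMorphisms)
import Algebra.Morphism.Construct.Composition as Composition
import Relation.Binary.Reasoning.Setoid as SetoidReasoning

private
  variable
    c ℓ c′ ℓ′ c″ ℓ″ : Level

IsHom : (G : Group c ℓ) (H : Group c′ ℓ′) → (Group.Carrier G → Group.Carrier H) →
        Set (c Level.⊔ ℓ Level.⊔ ℓ′)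
IsHom G H = GroupMorphisms.IsGroupHomomorphism (Group.rawGroup G) (Group.rawGroup H)

IsAut : (G : Group c ℓ) → (Group.Carrier G → Group.Carrier G) → Set (c Level.⊔ ℓ)
IsAut G = GroupMorphisms.IsGroupIsomorphism (Group.rawGroup G) (Group.rawGroup G)

∘-isHom : (G : Group c ℓ) (H : Group c′ ℓ′) (K : Group c″ ℓ″) {f : Group.Carrier G → Group.Carrier H}
          {k : Group.Carrier H → Group.Carrier K} →
          IsHom G H f → IsHom H K k → IsHom G K (λ x → k (f x))
∘-isHom G H K = Composition.isGroupHomomorphism (Group.trans K)

-- Commuting elements.  The centralizer of an element is a subgroup; this
-- is what lets us propagate commutation from generators to a whole image.

module Centralizer (G : Group c ℓ) where
  open Group G
  open SetoidReasoning setoid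

  Commute : Carrier → Carrier → Set ℓ
  Commute x y = x ∙ y ≈ y ∙ x

  commute-sym : ∀ {x y} → Commute x y → Commute y x
  commute-sym = sym

  commute-resp : ∀ {z x y} → x ≈ y → Commute z x → Commute z y
  commute-resp {z} {x} {y} x≈y zx = begin
    z ∙ y ≈⟨ ∙-congˡ (sym x≈y) ⟩
    z ∙ x ≈⟨ zx ⟩
    x ∙ z ≈⟨ ∙-congʳ x≈y ⟩
    y ∙ z ∎

  commute-ε : ∀ z → Commute z ε
  commute-ε z = trans (identityʳ z) (sym (identityˡ z))

  commute-∙ : ∀ {z x y} → Commute z x → Commute z y → Commute z (x ∙ y)
  commute-∙ {z} {x} {y} zx zy = begin
    z ∙ (x ∙ y) ≈⟨ sym (assoc z x y) ⟩
    (z ∙ x) ∙ y ≈⟨ ∙-congʳ zx ⟩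
    (x ∙ z) ∙ y ≈⟨ assoc x z y ⟩
    x ∙ (z ∙ y) ≈⟨ ∙-congˡ zy ⟩
    x ∙ (y ∙ z) ≈⟨ sym (assoc x y z) ⟩
    (x ∙ y) ∙ z ∎

  -- Conjugating z x = x z by x⁻¹ gives x⁻¹ z = z x⁻¹.
  commute-⁻¹ : ∀ {z x} → Commute z x → Commute z (x ⁻¹)
  commute-⁻¹ {z} {x} zx = begin
    z ∙ x ⁻¹                   ≈⟨ sym (identityˡ _) ⟩
    ε ∙ (z ∙ x ⁻¹)             ≈⟨ ∙-congʳ (sym (inverseˡ x)) ⟩
    (x ⁻¹ ∙ x) ∙ (z ∙ x ⁻¹)    ≈⟨ assoc _ _ _ ⟩
    x ⁻¹ ∙ (x ∙ (z ∙ x ⁻¹))    ≈⟨ ∙-congˡ (sym (assoc _ _ _)) ⟩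
    x ⁻¹ ∙ ((x ∙ z) ∙ x ⁻¹)    ≈⟨ ∙-congˡ (∙-congʳ (sym zx)) ⟩
    x ⁻¹ ∙ ((z ∙ x) ∙ x ⁻¹)    ≈⟨ ∙-congˡ (assoc _ _ _) ⟩
    x ⁻¹ ∙ (z ∙ (x ∙ x ⁻¹))    ≈⟨ ∙-congˡ (∙-congˡ (inverseʳ x)) ⟩
    x ⁻¹ ∙ (z ∙ ε)             ≈⟨ ∙-congˡ (identityʳ z) ⟩
    x ⁻¹ ∙ z                   ∎

-- Evaluation of words at a pair (s, t) of group elements: the
-- homomorphism F₂ → G with a ↦ s and b ↦ t.  For G = F₂ these are the
-- substitution endomorphisms used in the counterexample.

module Evaluation (G : Group c ℓ) (s t : Group.Carrier G) where
  open Group G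
  open SetoidReasoning setoid

  evalLetter : Letter → Carrier
  evalLetter a  = s
  evalLetter a⁻ = s ⁻¹
  evalLetter b  = t
  evalLetter b⁻ = t ⁻¹

  eval : Word → Carrier
  eval []      = ε
  eval (x ∷ w) = evalLetter x ∙ eval w

  eval-++ : ∀ u w → eval (u ++ w) ≈ eval u ∙ eval w
  eval-++ []      w = sym (identityˡ (eval w))
  eval-++ (x ∷ u) w = begin
    evalLetter x ∙ eval (u ++ w)       ≈⟨ ∙-congˡ (eval-++ u w) ⟩
    evalLetter x ∙ (eval u ∙ eval w)   ≈⟨ sym (assoc _ _ _) ⟩
    (evalLetter x ∙ eval u) ∙ eval w   ∎

  letter-cancel : ∀ x → evalLetter x ∙ evalLetter (invL x) ≈ ε
  letter-cancel a  = inverseʳ s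
  letter-cancel a⁻ = inverseˡ s
  letter-cancel b  = inverseʳ t
  letter-cancel b⁻ = inverseˡ t

  eval-cong : ∀ {u w} → u ~ w → eval u ≈ eval w
  eval-cong ~refl        = refl
  eval-cong (~sym p)     = sym (eval-cong p)
  eval-cong (~trans p q) = trans (eval-cong p) (eval-cong q)
  eval-cong (cancel x)   = trans (∙-congˡ (identityʳ _)) (letter-cancel x)
  eval-cong (~cong {u} {u'} {w} {w'} p q) = begin
    eval (u ++ w)       ≈⟨ eval-++ u w ⟩
    eval u ∙ eval w     ≈⟨ ∙-cong (eval-cong p) (eval-cong q) ⟩
    eval u' ∙ eval w'   ≈⟨ sym (eval-++ u' w') ⟩
    eval (u' ++ w')     ∎

  -- Inverses are preserved because eval (w⁻¹) ∙ eval w = eval (w⁻¹ w) = ε.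
  eval-invW : ∀ w → eval (invW w) ≈ eval w ⁻¹
  eval-invW w = GroupProperties.inverseˡ-unique G _ _
    (trans (sym (eval-++ (invW w) w)) (eval-cong (Group.inverseˡ F₂ w)))

  eval-isHom : IsHom F₂ G eval
  eval-isHom = record
    { isMonoidHomomorphism = record
      { isMagmaHomomorphism = record
        { isRelHomomorphism = record { cong = eval-cong }
        ; homo = eval-++ }
      ; ε-homo = refl }
    ; ⁻¹-homo = eval-invW }

-- Everything in the image of k is a product of
-- k a, k b and their inverses, so it commutes with whatever those commute
-- with.  If moreover k kills a, the image is generated by k b and is abelian.

module HomsFromF₂ (G : Group c ℓ) (k : Word → Group.Carrier G) (k-hom : IsHom F₂ G k) where
  open Group G
  open Centralizer G
  open GroupMorphisms.IsGroupHomomorphism k-hom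

  centralizes-image : ∀ {z} → Commute z (k [ a ]) → Commute z (k [ b ]) →
                      ∀ w → Commute z (k w)
  centralizes-image {z} za zb = go
    where
    letter : ∀ x → Commute z (k [ x ])
    letter a  = za
    letter a⁻ = commute-resp (sym (⁻¹-homo [ a ])) (commute-⁻¹ za)
    letter b  = zb
    letter b⁻ = commute-resp (sym (⁻¹-homo [ b ])) (commute-⁻¹ zb)

    go : ∀ w → Commute z (k w)
    go []      = commute-resp (sym ε-homo) (commute-ε z)
    go (x ∷ w) = commute-resp (sym (homo [ x ] w)) (commute-∙ (letter x) (go w))

  killing-a⇒abelian-image : k [ a ] ≈ ε → ∀ u w → Commute (k u) (k w)
  killing-a⇒abelian-image ka≈ε u = centralizes-image (killsA (k u)) (commute-sym kb-central)
    where
    killsA : ∀ z → Commute z (k [ a ])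
    killsA z = commute-resp (sym ka≈ε) (commute-ε z)

    kb-central : Commute (k [ b ]) (k u)
    kb-central = centralizes-image (killsA (k [ b ])) refl u

module Subgroups (G : Group c ℓ) where
  open Group G
  open GroupMorphisms.IsGroupHomomorphism

  image-⟨⟩ : (k : Carrier → Carrier) → IsHom G G k → ∀ {gs gs′} →
             (∀ {x} → x ∈ gs → ⟨_⟩ G gs′ (k x)) → ∀ {x} → ⟨_⟩ G gs x → ⟨_⟩ G gs′ (k x)
  image-⟨⟩ k k-hom onGens (gen p)   = onGens p
  image-⟨⟩ k k-hom onGens one       = resp (sym (ε-homo k-hom)) one
  image-⟨⟩ k k-hom onGens (inv p)   =
    resp (sym (⁻¹-homo k-hom _)) (inv (image-⟨⟩ k k-hom onGens p))
  image-⟨⟩ k k-hom onGens (mul p q) =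
    resp (sym (homo k-hom _ _)) (mul (image-⟨⟩ k k-hom onGens p) (image-⟨⟩ k k-hom onGens q))
  image-⟨⟩ k k-hom onGens (resp e p) = resp (⟦⟧-cong k-hom e) (image-⟨⟩ k k-hom onGens p)

  fixes-⟨⟩ : (k : Carrier → Carrier) → IsHom G G k → ∀ {gs} →
             (∀ {x} → x ∈ gs → k x ≈ x) → ∀ {x} → ⟨_⟩ G gs x → k x ≈ x
  fixes-⟨⟩ k k-hom fixGens (gen p)    = fixGens p
  fixes-⟨⟩ k k-hom fixGens one        = ε-homo k-hom
  fixes-⟨⟩ k k-hom fixGens (inv p)    =
    trans (⁻¹-homo k-hom _) (⁻¹-cong (fixes-⟨⟩ k k-hom fixGens p))
  fixes-⟨⟩ k k-hom fixGens (mul p q)  =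
    trans (homo k-hom _ _) (∙-cong (fixes-⟨⟩ k k-hom fixGens p) (fixes-⟨⟩ k k-hom fixGens q))
  fixes-⟨⟩ k k-hom fixGens (resp e p) =
    trans (⟦⟧-cong k-hom (sym e)) (trans (fixes-⟨⟩ k k-hom fixGens p) e)

  restrict : (f g : Carrier → Carrier) (f-hom : IsHom G G f) (g-hom : IsHom G G g) →
             ∀ {gsA gsB} →
             (∀ {x} → x ∈ gsA → ⟨_⟩ G gsB (f x)) → (∀ {y} → y ∈ gsB → ⟨_⟩ G gsA (g y)) →
             (∀ {x} → x ∈ gsA → g (f x) ≈ x) → (∀ {y} → y ∈ gsB → f (g y) ≈ y) →
             SubIso G gsA gsB
  restrict f g f-hom g-hom fA gB gfA fgB = record
    { to        = λ x → f (proj₁ x) , image-⟨⟩ f f-hom fA (proj₂ x)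
    ; from      = λ y → g (proj₁ y) , image-⟨⟩ g g-hom gB (proj₂ y)
    ; to-cong   = λ _ _ → ⟦⟧-cong f-hom
    ; from-cong = λ _ _ → ⟦⟧-cong g-hom
    ; to-hom    = λ x y → homo f-hom (proj₁ x) (proj₁ y)
    ; from-to   = λ x → fixes-⟨⟩ (λ z → g (f z)) (∘-isHom G G G f-hom g-hom) gfA (proj₂ x)
    ; to-from   = λ y → fixes-⟨⟩ (λ z → f (g z)) (∘-isHom G G G g-hom f-hom) fgB (proj₂ y)
    }

Sym : ℕ → Group Level.zero Level.zero
Sym n = record
  { Carrier = Permutation′ n
  ; _≈_     = Perm._≈_
  ; _∙_     = _∘ₚ_
  ; ε       = Perm.id
  ; _⁻¹     = Perm.flip
  ; isGroup = record
    { isMonoid = record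
      { isSemigroup = record
        { isMagma = record
          { isEquivalence = record
            { refl  = λ _ → ≡.refl
            ; sym   = λ p i → ≡.sym (p i)
            ; trans = λ p q i → ≡.trans (p i) (q i) }
          ; ∙-cong = λ {_} {π′} {σ} p q i → ≡.trans (≡.cong (σ ⟨$⟩ʳ_) (p i)) (q (π′ ⟨$⟩ʳ i)) }
        ; assoc = λ _ _ _ _ → ≡.refl }
      ; identity = (λ _ _ → ≡.refl) , (λ _ _ → ≡.refl) }
    ; inverse = (λ π _ → Perm.inverseʳ π) , (λ π _ → Perm.inverseˡ π)
    ; ⁻¹-cong = λ {π} {π′} → flip-cong {π} {π′} }
  }
  where
  flip-cong : ∀ {π π′ : Permutation′ n} → Perm._≈_ π π′ → ∀ i → π ⟨$⟩ˡ i ≡ π′ ⟨$⟩ˡ i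
  flip-cong {π} {π′} π≈π′ i = begin
    π ⟨$⟩ˡ i                        ≡⟨ Perm.inverseˡ π′ ⟨
    π′ ⟨$⟩ˡ (π′ ⟨$⟩ʳ (π ⟨$⟩ˡ i))    ≡⟨ ≡.cong (π′ ⟨$⟩ˡ_) (π≈π′ _) ⟨
    π′ ⟨$⟩ˡ (π ⟨$⟩ʳ (π ⟨$⟩ˡ i))     ≡⟨ ≡.cong (π′ ⟨$⟩ˡ_) (Perm.inverseʳ π) ⟩
    π′ ⟨$⟩ˡ i                       ∎
    where open ≡.≡-Reasoning

-- The obstruction: if an automorphism h of F₂ sends a to w (so w is
-- primitive), then every pair (s, t) in every group at which w evaluates
-- to 1 is a commuting pair.  Indeed k = eval (s, t) ∘ h kills a, and s, t
-- lie in the image of k because h is surjective.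

primitive-killers-commute :
  (h : Word → Word) → IsAut F₂ h →
  ∀ {w} → h [ a ] ~ w →
  (G : Group c ℓ) (s t : Group.Carrier G) →
  Group._≈_ G (Evaluation.eval G s t w) (Group.ε G) → Centralizer.Commute G s t
primitive-killers-commute h h-iso {w} ha~w G s t w↦ε =
  commute-sym (commute-resp (k-preimage a) (commute-sym (commute-resp (k-preimage b) image-abelian)))
  where
  open Group G
  open Centralizer G
  open Evaluation G s t
  open GroupMorphisms.IsGroupIsomorphism h-iso using (isGroupHomomorphism; surjective)

  k : Word → Carrier
  k x = eval (h x)

  preimage : Letter → Word
  preimage x = proj₁ (surjective [ x ])

  k-preimage : ∀ x → k (preimage x) ≈ evalLetter x
  k-preimage x = trans (eval-cong (proj₂ (surjective [ x ]) ~refl)) (identityʳ _)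

  image-abelian : Commute (k (preimage a)) (k (preimage b))
  image-abelian = HomsFromF₂.killing-a⇒abelian-image G k
    (∘-isHom F₂ F₂ G isGroupHomomorphism eval-isHom)
    (trans (eval-cong ha~w) w↦ε) (preimage a) (preimage b)

v : Word
v = a ∷ a ∷ b ∷ a⁻ ∷ b ∷ []

f g : Word → Word
f = Evaluation.eval F₂ v [ b ]
g = Evaluation.eval F₂ [ a ] []

f-hom : IsHom F₂ F₂ f
f-hom = Evaluation.eval-isHom F₂ v [ b ]

g-hom : IsHom F₂ F₂ g
g-hom = Evaluation.eval-isHom F₂ [ a ] []

-- g v = a a a⁻¹ ~ a
g-v : g v ~ [ a ]
g-v = ~cong {[ a ]} ~refl (cancel a)

-- f maps a to v and g maps v into ⟨ a ⟩; both g (f a) and f (g v) reduce via g v ~ a.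
φ : SubIso F₂ [ [ a ] ] [ v ]
φ = Subgroups.restrict F₂ f g f-hom g-hom
  (λ { (here ≡.refl) → gen (here ≡.refl) })
  (λ { (here ≡.refl) → resp (~sym g-v) (gen (here ≡.refl)) })
  (λ { (here ≡.refl) → g-v })
  (λ { (here ≡.refl) → GroupMorphisms.IsGroupHomomorphism.⟦⟧-cong f-hom g-v })

s t : Permutation′ 3
s = transpose 0F 1F ∘ₚ transpose 1F 2F
t = transpose 0F 1F

v-killed : Group._≈_ (Sym 3) (Evaluation.eval (Sym 3) s t v) (Group.ε (Sym 3))
v-killed 0F = ≡.refl
v-killed 1F = ≡.refl
v-killed 2F = ≡.refl

-- the two products already differ at 0: one sends it to 2, the other fixes it
s-t-noncommuting : ¬ Centralizer.Commute (Sym 3) s t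
s-t-noncommuting st≈ts with st≈ts 0F
... | ()

proposition4p6 : ¬ WeaklyHomogeneous F₂
proposition4p6 weaklyHomogeneous =
  s-t-noncommuting (primitive-killers-commute h h-iso h-a (Sym 3) s t v-killed)
  where
  extension : ExtendsToAuto F₂ (SubIso.to φ)
  extension = weaklyHomogeneous [ [ a ] ] [ v ] φ (f , f-hom , λ _ → ~refl) (g , g-hom , λ _ → ~refl)
  h : Word → Word
  h = proj₁ extension

  h-iso : IsAut F₂ h
  h-iso = proj₁ (proj₂ extension)

  h-a : h [ a ] ~ v
  h-a = proj₂ (proj₂ extension) ([ a ] , gen (here ≡.refl))
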